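{- There exists a planar graph $G$ that is not $3$-defective $3$-correspondable; that is, there is a $3$-fold correspondence cover $\mathcal{H}$ of $G$ such that $G$ admits no $3$-defective $\mathcal{H}$-coloring.
   Context: All graphs are finite, simple and undirected. A correspondence cover of a graph $G$ is a pair $\mathcal{H}=(L,H)$ where $H$ is a graph and $L: V(G)\to 2^{V(H)}$ satisfies: (1) $\{L(v): v\in V(G)\}$ partitions $V(H)$; (2) each $L(v)$ is an independent set in $H$; (3) for all $u,v\in V(G)$, the edges of $H[L(u)\cup L(v)]$ form a matching, which is empty if $uv\notin E(G)$. The cover is $k$-fold if $|L(v)|\ge k$ for all $v$. Two colors $c,c'\in V(H)$ conflict if $cc'\in E(H)$. An $\mathcal{H}$-coloring is a map $\phi:V(G)\to V(H)$ with $\phi(v)\in L(v)$ for all $v$. It is $d$-defective if the subgraph of $H$ induced by the image of $\phi$ has maximum degree at most $d$, i.e., for every $v$, $\phi(v)$ conflicts with $\phi(u)$ for at most $d$ neighbors $u$ of $v$ in $G$. A graph $G$ is $d$-defective $k$-correspondable if it has a $d$-defective $\mathcal{H}$-coloring for every $k$-fold correspondence cover $\mathcal{H}$ of $G$. -}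

module Defs where

open import Data.Nat using (ℕ; zero; suc; _≤_)
open import Data.Bool using (Bool; true; false; _∧_; if_then_else_)
open import Data.Fin using (Fin; zero; suc)
open import Data.Product using (Σ; _×_; _,_; ∃; ∃-syntax)
open import Data.Rational using (ℚ; 0ℚ; 1ℚ) renaming (_+_ to _+ℚ_; _*_ to _*ℚ_; _-_ to _-ℚ_; _≤_ to _≤ℚ_)
open import Function.Definitions using (Injective)
open import Relation.Binary.PropositionalEquality using (_≡_)
open import Relation.Nullary using (¬_)

record SimpleGraph (n : ℕ) : Set where
  field
    adj    : Fin n → Fin n → Bool
    sym    : ∀ u v → adj u v ≡ adj v u
    irrefl : ∀ v → adj v v ≡ false

open SimpleGraph public

count : {n : ℕ} → (Fin n → Bool) → ℕ
count {zero}  f = 0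
count {suc n} f = (if f zero then 1 else 0) Data.Nat.+ count (λ i → f (suc i))

Point : Set
Point = ℚ × ℚ

OnSegment : Point → Point → Point → Set
OnSegment (px , py) (ax , ay) (bx , by) =
  Σ ℚ λ t → (0ℚ ≤ℚ t) × (t ≤ℚ 1ℚ)
          × (px ≡ ax +ℚ t *ℚ (bx -ℚ ax))
          × (py ≡ ay +ℚ t *ℚ (by -ℚ ay))

SegmentsMeet : Point → Point → Point → Point → Set
SegmentsMeet a b c d = Σ Point λ p → OnSegment p a b × OnSegment p c d

record PlanarDrawing {n : ℕ} (G : SimpleGraph n) : Set where
  field
    pos         : Fin n → Point
    pos-inj     : Injective _≡_ _≡_ pos
    vertex-free : ∀ u v w → adj G u v ≡ true → ¬ (w ≡ u) → ¬ (w ≡ v) →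
                  ¬ OnSegment (pos w) (pos u) (pos v)
    edge-free   : ∀ u v x y → adj G u v ≡ true → adj G x y ≡ true →
                  ¬ (u ≡ x) → ¬ (u ≡ y) → ¬ (v ≡ x) → ¬ (v ≡ y) →
                  ¬ SegmentsMeet (pos u) (pos v) (pos x) (pos y)

Planar : {n : ℕ} → SimpleGraph n → Set
Planar G = PlanarDrawing G

-- Correspondence covers.
-- V(H) = Fin m; the map `owner` sends a color c to the unique v with
-- c ∈ L(v), so L(v) = { c | owner c ≡ v } and {L(v)} partitions V(H).

record CorrespondenceCover {n : ℕ} (G : SimpleGraph n) : Set where
  field
    m        : ℕ
    H        : SimpleGraph m
    owner    : Fin m → Fin n
    indep    : ∀ c c' → owner c ≡ owner c' → adj H c c' ≡ false
    -- (3) edges between L(u) and L(v) form a matching ...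
    matching : ∀ c c' c'' → owner c' ≡ owner c'' →
               adj H c c' ≡ true → adj H c c'' ≡ true → c' ≡ c''
    -- ... which is empty if uv ∉ E(G)
    respects : ∀ c c' → adj H c c' ≡ true → adj G (owner c) (owner c') ≡ true

open CorrespondenceCover public

InList : {n : ℕ} {G : SimpleGraph n} (𝓗 : CorrespondenceCover G) → Fin n → Fin (m 𝓗) → Set
InList 𝓗 v c = owner 𝓗 c ≡ v

KFold : {n : ℕ} {G : SimpleGraph n} → ℕ → CorrespondenceCover G → Set
KFold {n} k 𝓗 = ∀ (v : Fin n) →
  Σ (Fin k → Fin (m 𝓗)) λ f → Injective _≡_ _≡_ f × (∀ i → owner 𝓗 (f i) ≡ v)

record HColoring {n : ℕ} {G : SimpleGraph n} (𝓗 : CorrespondenceCover G) : Set where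
  field
    φ    : Fin n → Fin (m 𝓗)
    φ∈L  : ∀ v → owner 𝓗 (φ v) ≡ v

open HColoring public

Defective : {n : ℕ} {G : SimpleGraph n} {𝓗 : CorrespondenceCover G} →
            ℕ → HColoring 𝓗 → Set
Defective {n} {G} {𝓗} d col =
  ∀ (v : Fin n) → count (λ u → adj G v u ∧ adj (H 𝓗) (φ col v) (φ col u)) ≤ d

DefectiveCorrespondable : {n : ℕ} → ℕ → ℕ → SimpleGraph n → Set
DefectiveCorrespondable {n} d k G =
  ∀ (𝓗 : CorrespondenceCover G) → KFold k 𝓗 →
  Σ (HColoring 𝓗) λ col → Defective d col

-- South and north are joined to 21 copies of a gadget: a path p₀ … p₄ with two triangles on each of
-- its edges p₁p₂ and p₂p₃, one joined to south and one to north.  The cover is given by voltages in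
-- ℤ/3.  In a 3-defective colouring with colours a at south and b at north, consider the seven copies
-- whose north voltage is a + 1 - b.  A copy in which no vertex conflicts with an apex would have its
-- colours forced: a + 2 on the path, so that every path vertex conflicts with its path neighbours,
-- and on each triangle one of two colours, each conflicting with exactly one of its two path
-- vertices; the four triangles then give one of p₁ , p₂ , p₃ a fourth conflict.  So each of the
-- seven copies has a vertex in conflict with south or north, and one apex has four conflicts.
-- Planarity is certified by an integer drawing in which any two disjoint edges, and any edge and
-- vertex off it, are separated by a line.
module Submission where

open import Defs hiding (sym)
open import Data.Bool using (Bool; true; false; _∧_; _∨_; not; T; if_then_else_)
import Data.Bool.Properties as Bool
open import Data.Bool.ListAction using (any; all)
open import Data.Empty using (⊥; ⊥-elim)
open import Data.Fin using (Fin; zero; suc; toℕ; fromℕ<; combine; remQuot; _≟_)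
open import Data.Fin.Properties
  using (all?; any?; +↔⊎; *↔×; combine-remQuot; remQuot-combine; combine-injectiveʳ)
open import Data.Integer using (ℤ; +_; -_)
import Data.Integer as ℤ
import Data.Integer.Properties as ℤ
open import Data.List using (List; []; _∷_; _++_; length; map; concatMap; allFin; filter; cartesianProduct)
open import Data.List.Membership.Propositional using (_∈_)
open import Data.List.Membership.Propositional.Properties
  using (∈-allFin; ∈-map⁺; ∈-++⁺ˡ; ∈-++⁺ʳ; ∈-concatMap⁺; ∈-cartesianProduct⁺; ∈-filter⁺)
open import Data.List.Properties using (length-map; length-tabulate)
open import Data.List.Relation.Unary.All as All using (All; []; _∷_)
import Data.List.Relation.Unary.All.Properties as All
open import Data.List.Relation.Unary.Any as Any using (here; there; satisfied)
open import Data.List.Relation.Unary.Any.Properties using (any⁻)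
open import Data.List.Relation.Unary.AllPairs using ([]; _∷_)
open import Data.List.Relation.Unary.Unique.Propositional using (Unique)
import Data.List.Relation.Unary.Unique.Propositional.Properties as Unique
import Data.List.Relation.Unary.Unique.DecPropositional as UniqueDec
open import Data.Maybe using (Maybe; just; nothing; is-just; fromMaybe)
open import Data.Nat using (ℕ; zero; suc; _+_; _*_; _∸_; _≤_; z≤n; s≤s)
open import Data.Nat.DivMod using (m%n<n)
open import Data.Nat.Properties using (+-suc; +-monoʳ-≤; +-mono-≤; ≤-reflexive; ≤-trans; n≤1+n; n≮n)
open import Data.Product using (Σ; ∃; _×_; _,_; proj₁; proj₂)
open import Data.Product.Function.NonDependent.Propositional using (_×-↔_)
import Data.Product.Properties as Product
open import Data.Rational using (ℚ; 0ℚ; 1ℚ; *≤*; nonNegative)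
  renaming (_+_ to _+ℚ_; _*_ to _*ℚ_; _-_ to _-ℚ_; -_ to -ℚ_; _≤_ to _≤ℚ_)
import Data.Rational.Properties as ℚ
open import Data.Rational.Literals using (fromℤ)
open import Data.Rational.Solver using (module +-*-Solver)
import Data.Rational.Unnormalised as ℚᵘ
import Data.Rational.Unnormalised.Properties as ℚᵘ
open import Data.Sum using (_⊎_; inj₁; inj₂)
open import Data.Sum.Function.Propositional using (_⊎-↔_)
import Data.Sum.Properties as Sum
open import Function using (_∘_; id; _↔_; Inverse; Equivalence)
open import Function.Definitions using (Injective)
open import Function.Properties.Inverse using (↔-refl; ↔-trans)
open import Relation.Binary.Definitions using (DecidableEquality)
open import Relation.Binary.PropositionalEquality
open import Relation.Nullary using (¬_; Dec; yes; no; does; contradiction; ¬?; _→-dec_; _⊎-dec_)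
open import Relation.Nullary.Decidable using (from-yes; dec-true; does-≡; map′; True; toWitness; T?)
open import Relation.Unary using (Decidable)

open +-*-Solver

infixl 6 _+₃_ _-₃_

_+₃_ _-₃_ : Fin 3 → Fin 3 → Fin 3
i +₃ j = fromℕ< (m%n<n (toℕ i + toℕ j) 3)
i -₃ j = fromℕ< (m%n<n (toℕ i + (3 ∸ toℕ j)) 3)

one two : Fin 3
one = suc zero
two = suc (suc zero)

+₃-identityʳ : ∀ i → i +₃ zero ≡ i
+₃-identityʳ = from-yes (all? λ i → i +₃ zero ≟ i)

+₃-cancel : ∀ i s t → i +₃ (s -₃ t) +₃ (t -₃ s) ≡ i
+₃-cancel = from-yes (all? λ i → all? λ s → all? λ t → i +₃ (s -₃ t) +₃ (t -₃ s) ≟ i)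

count-∨ : ∀ {n} (f g : Fin n → Bool) → count (λ i → f i ∨ g i) ≤ count f + count g
count-∨ {zero}  f g = z≤n
count-∨ {suc n} f g with f zero | g zero
... | true  | true  = s≤s (≤-trans (count-∨ (f ∘ suc) (g ∘ suc)) (+-monoʳ-≤ (count (f ∘ suc)) (n≤1+n _)))
... | true  | false = s≤s (count-∨ (f ∘ suc) (g ∘ suc))
... | false | true  = ≤-trans (s≤s (count-∨ (f ∘ suc) (g ∘ suc))) (≤-reflexive (sym (+-suc _ _)))
... | false | false = count-∨ (f ∘ suc) (g ∘ suc)

count-cong : ∀ {n} {f g : Fin n → Bool} → (∀ i → f i ≡ g i) → count f ≡ count g
count-cong {zero}          _   = refl
count-cong {suc n} {f} {g} f≗g rewrite f≗g zero = cong₂ _+_ refl (count-cong (f≗g ∘ suc))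

count-remove : ∀ {n} (f : Fin n → Bool) {u} → f u ≡ true →
               count f ≡ suc (count (λ i → not (does (u ≟ i)) ∧ f i))
count-remove f {zero}  fu rewrite fu = refl
count-remove f {suc u} fu rewrite count-remove (f ∘ suc) fu = +-suc _ _

count-unique : ∀ {n} (f : Fin n → Bool) {xs} → Unique xs → All (λ i → f i ≡ true) xs →
               length xs ≤ count f
count-unique f                []                 []          = z≤n
count-unique f {xs = u ∷ xs} (u∉xs ∷ unique-xs) (fu ∷ f-xs) rewrite count-remove f fu =
  s≤s (count-unique _ unique-xs (All.zipWith (λ (u≢i , fi) → still-true u≢i fi) (u∉xs , f-xs)))
  where
  still-true : ∀ {i} → ¬ u ≡ i → f i ≡ true → not (does (u ≟ i)) ∧ f i ≡ true
  still-true {i} u≢i fi with u ≟ i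
  ... | no  _   = fi
  ... | yes u≡i = contradiction u≡i u≢i

count-injective : ∀ {m n} (f : Fin n → Bool) {g : Fin m → Fin n} → Injective _≡_ _≡_ g →
                  (∀ i → f (g i) ≡ true) → m ≤ count f
count-injective {m} f {g} g-injective fg≡true =
  subst (_≤ count f) (trans (length-map g (allFin m)) (length-tabulate id))
        (count-unique f (Unique.map⁺ g-injective (Unique.allFin⁺ m)) (All.map⁺ (All.tabulate⁺ fg≡true)))

symmetrise : ∀ {n} (arc : Fin n → Fin n → Bool) → (∀ v → arc v v ≡ false) → SimpleGraph n
symmetrise arc loopless = record
  { adj    = λ u v → arc u v ∨ arc v u
  ; sym    = λ u v → Bool.∨-comm (arc u v) (arc v u)
  ; irrefl = λ v → cong₂ _∨_ (loopless v) (loopless v)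
  }

-- L(v) = {v} × Fin k, stored in Fin (n * k) via combine; the colours (v , i) and (u , j) conflict
-- iff uv ∈ E(G) and j = π v u i.
module PermutationCover {n} (G : SimpleGraph n) (k : ℕ) (π : Fin n → Fin n → Fin k → Fin k)
                        (π-inverse : ∀ v u i → π u v (π v u i) ≡ i) where

  vertexOf : Fin (n * k) → Fin n
  vertexOf = proj₁ ∘ remQuot {n} k

  colourOf : Fin (n * k) → Fin k
  colourOf = proj₂ ∘ remQuot {n} k

  conflicts : Fin (n * k) → Fin (n * k) → Bool
  conflicts c c' = adj G (vertexOf c) (vertexOf c') ∧
                   does (colourOf c' ≟ π (vertexOf c) (vertexOf c') (colourOf c))

  private
    matched-sym : ∀ v u i j → does (j ≟ π v u i) ≡ does (i ≟ π u v j)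
    matched-sym v u i j = does-≡ (j ≟ π v u i) (map′ from to (i ≟ π u v j))
      where
      to : j ≡ π v u i → i ≡ π u v j
      to refl = sym (π-inverse v u i)
      from : i ≡ π u v j → j ≡ π v u i
      from refl = sym (π-inverse u v j)

    matched : ∀ {i j : Fin k} → does (i ≟ j) ≡ true → i ≡ j
    matched {i} {j} _ with i ≟ j
    ... | yes i≡j = i≡j

    conflicts-irrefl : ∀ c c' → vertexOf c ≡ vertexOf c' → conflicts c c' ≡ false
    conflicts-irrefl c c' same rewrite same | irrefl G (vertexOf c') = refl

    pair-injective : ∀ {c c'} → vertexOf c ≡ vertexOf c' → colourOf c ≡ colourOf c' → c ≡ c'
    pair-injective {c} {c'} e₁ e₂ =
      trans (sym (combine-remQuot {n} k c)) (trans (cong₂ combine e₁ e₂) (combine-remQuot {n} k c'))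

  coverGraph : SimpleGraph (n * k)
  coverGraph = record
    { adj    = conflicts
    ; sym    = λ c c' → cong₂ _∧_ (SimpleGraph.sym G (vertexOf c) (vertexOf c'))
                                  (matched-sym (vertexOf c) (vertexOf c') (colourOf c) (colourOf c'))
    ; irrefl = λ c → conflicts-irrefl c c refl
    }

  cover : CorrespondenceCover G
  cover = record
    { m        = n * k
    ; H        = coverGraph
    ; owner    = vertexOf
    ; indep    = conflicts-irrefl
    ; matching = λ c c' c'' same h h' →
        pair-injective same (trans (matched (Bool.∧-conicalʳ (adj G _ _) _ h))
          (sym (subst (λ u → colourOf c'' ≡ π (vertexOf c) u (colourOf c)) (sym same)
                      (matched (Bool.∧-conicalʳ (adj G _ _) _ h')))))
    ; respects = λ c c' h → Bool.∧-conicalˡ _ _ h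
    }

  kFold : KFold k cover
  kFold v = combine v , (λ {i} {j} → combine-injectiveʳ {n} v i v j) , λ i → cong proj₁ (remQuot-combine v i)

  conflict : (col : HColoring cover) → ∀ {v u} → adj G v u ≡ true →
             colourOf (φ col u) ≡ π v u (colourOf (φ col v)) →
             adj G v u ∧ adj coverGraph (φ col v) (φ col u) ≡ true
  conflict col {v} {u} vu matches
    rewrite φ∈L col v | φ∈L col u | vu | dec-true (colourOf (φ col u) ≟ _) matches = refl

-- Segments in the rational plane

opaque
  ι : ℤ → ℚ
  ι = fromℤ

opaque
  unfolding ι

  ι-+ : ∀ a b → ι (a ℤ.+ b) ≡ ι a +ℚ ι b
  ι-+ a b = ℚ.toℚᵘ-injective (ℚᵘ.≃-trans
    (ℚᵘ.*≡* (cong (ℤ._* ℤ.1ℤ) (sym (cong₂ ℤ._+_ (ℤ.*-identityʳ a) (ℤ.*-identityʳ b)))))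
    (ℚᵘ.≃-sym (ℚ.toℚᵘ-homo-+ (ι a) (ι b))))

  ι-* : ∀ a b → ι (a ℤ.* b) ≡ ι a *ℚ ι b
  ι-* a b = ℚ.toℚᵘ-injective (ℚᵘ.≃-trans (ℚᵘ.*≡* refl) (ℚᵘ.≃-sym (ℚ.toℚᵘ-homo-* (ι a) (ι b))))

  ι-mono-≤ : ∀ {a b} → a ℤ.≤ b → ι a ≤ℚ ι b
  ι-mono-≤ {a} {b} a≤b = *≤* (subst₂ ℤ._≤_ (sym (ℤ.*-identityʳ a)) (sym (ℤ.*-identityʳ b)) a≤b)

  ι-cancel-≤ : ∀ {a b} → ι a ≤ℚ ι b → a ℤ.≤ b
  ι-cancel-≤ {a} {b} (*≤* a≤b) = subst₂ ℤ._≤_ (ℤ.*-identityʳ a) (ℤ.*-identityʳ b) a≤b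

embed : ℤ × ℤ → Point
embed (x , y) = ι x , ι y

embed-injective : ∀ {p q} → embed p ≡ embed q → p ≡ q
embed-injective {x , y} {x' , y'} e = cong₂ _,_ (ι-injective (cong proj₁ e)) (ι-injective (cong proj₂ e))
  where
  ι-injective : ∀ {a b} → ι a ≡ ι b → a ≡ b
  ι-injective e = ℤ.≤-antisym (ι-cancel-≤ (ℚ.≤-reflexive e)) (ι-cancel-≤ (ℚ.≤-reflexive (sym e)))

infix 7 _·ℤ_ _·ℚ_

_·ℤ_ : ℤ × ℤ → ℤ × ℤ → ℤ
(α , β) ·ℤ (x , y) = α ℤ.* x ℤ.+ β ℤ.* y

_·ℚ_ : ℚ × ℚ → Point → ℚ
(α , β) ·ℚ (x , y) = α *ℚ x +ℚ β *ℚ y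

·-embed : ∀ ℓ p → embed ℓ ·ℚ embed p ≡ ι (ℓ ·ℤ p)
·-embed (α , β) (x , y) = sym (trans (ι-+ (α ℤ.* x) (β ℤ.* y)) (cong₂ _+ℚ_ (ι-* α x) (ι-* β y)))

0≤1-t : ∀ {t} → t ≤ℚ 1ℚ → 0ℚ ≤ℚ 1ℚ -ℚ t
0≤1-t {t} t≤1 = subst (_≤ℚ 1ℚ -ℚ t) (ℚ.+-inverseʳ t) (ℚ.+-monoˡ-≤ (-ℚ t) t≤1)

1-t≤1 : ∀ {t} → 0ℚ ≤ℚ t → 1ℚ -ℚ t ≤ℚ 1ℚ
1-t≤1 0≤t = ℚ.+-monoʳ-≤ 1ℚ (ℚ.neg-antimono-≤ 0≤t)

onSegment-start : ∀ a b → OnSegment a a b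
onSegment-start (ax , ay) (bx , by) = 0ℚ , ℚ.≤-refl , *≤* (ℤ.+≤+ z≤n) , start ax bx , start ay by
  where
  start : ∀ u v → u ≡ u +ℚ 0ℚ *ℚ (v -ℚ u)
  start = solve 2 (λ u v → u := u :+ con 0ℚ :* (v :- u)) refl

onSegment-sym : ∀ {p} a b → OnSegment p a b → OnSegment p b a
onSegment-sym (ax , ay) (bx , by) (t , 0≤t , t≤1 , px , py) =
  1ℚ -ℚ t , 0≤1-t t≤1 , 1-t≤1 0≤t , trans px (reverse ax bx t) , trans py (reverse ay by t)
  where
  reverse : ∀ u v t → u +ℚ t *ℚ (v -ℚ u) ≡ v +ℚ (1ℚ -ℚ t) *ℚ (u -ℚ v)
  reverse = solve 3 (λ u v t → u :+ t :* (v :- u) := v :+ (con 1ℚ :- t) :* (u :- v)) refl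

segmentsMeet-sym : ∀ a b c d → SegmentsMeet a b c d → SegmentsMeet c d a b
segmentsMeet-sym _ _ _ _ (p , on-ab , on-cd) = p , on-cd , on-ab

private
  affine : ∀ u v t → u +ℚ t *ℚ (v -ℚ u) ≡ (1ℚ -ℚ t) *ℚ u +ℚ t *ℚ v
  affine = solve 3 (λ u v t → u :+ t :* (v :- u) := (con 1ℚ :- t) :* u :+ t :* v) refl

  split : ∀ K t → K ≡ (1ℚ -ℚ t) *ℚ K +ℚ t *ℚ K
  split = solve 2 (λ K t → K := (con 1ℚ :- t) :* K :+ t :* K) refl

convex-≤ : ∀ {u v t K} → 0ℚ ≤ℚ t → t ≤ℚ 1ℚ → u ≤ℚ K → v ≤ℚ K → u +ℚ t *ℚ (v -ℚ u) ≤ℚ K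
convex-≤ {u} {v} {t} {K} 0≤t t≤1 u≤K v≤K = subst₂ _≤ℚ_ (sym (affine u v t)) (sym (split K t))
  (ℚ.+-mono-≤ (ℚ.*-monoˡ-≤-nonNeg (1ℚ -ℚ t) {{nonNegative (0≤1-t t≤1)}} u≤K)
              (ℚ.*-monoˡ-≤-nonNeg t {{nonNegative 0≤t}} v≤K))

convex-≥ : ∀ {u v t K} → 0ℚ ≤ℚ t → t ≤ℚ 1ℚ → K ≤ℚ u → K ≤ℚ v → K ≤ℚ u +ℚ t *ℚ (v -ℚ u)
convex-≥ {u} {v} {t} {K} 0≤t t≤1 K≤u K≤v = subst₂ _≤ℚ_ (sym (split K t)) (sym (affine u v t))
  (ℚ.+-mono-≤ (ℚ.*-monoˡ-≤-nonNeg (1ℚ -ℚ t) {{nonNegative (0≤1-t t≤1)}} K≤u)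
              (ℚ.*-monoˡ-≤-nonNeg t {{nonNegative 0≤t}} K≤v))

·-onSegment : ∀ ℓ {p a b} → OnSegment p a b →
              Σ ℚ λ t → (0ℚ ≤ℚ t) × (t ≤ℚ 1ℚ) × (ℓ ·ℚ p ≡ ℓ ·ℚ a +ℚ t *ℚ (ℓ ·ℚ b -ℚ ℓ ·ℚ a))
·-onSegment (α , β) {a = ax , ay} {b = bx , by} (t , 0≤t , t≤1 , refl , refl) =
  t , 0≤t , t≤1 , linear α β ax ay bx by t
  where
  linear : ∀ α β ax ay bx by t →
           α *ℚ (ax +ℚ t *ℚ (bx -ℚ ax)) +ℚ β *ℚ (ay +ℚ t *ℚ (by -ℚ ay)) ≡
           α *ℚ ax +ℚ β *ℚ ay +ℚ t *ℚ ((α *ℚ bx +ℚ β *ℚ by) -ℚ (α *ℚ ax +ℚ β *ℚ ay))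
  linear = solve 7 (λ α β ax ay bx by t →
    α :* (ax :+ t :* (bx :- ax)) :+ β :* (ay :+ t :* (by :- ay)) :=
    α :* ax :+ β :* ay :+ t :* ((α :* bx :+ β :* by) :- (α :* ax :+ β :* ay))) refl

onSegment-≤ : ∀ ℓ {p a b K} → OnSegment p a b → ℓ ·ℚ a ≤ℚ K → ℓ ·ℚ b ≤ℚ K → ℓ ·ℚ p ≤ℚ K
onSegment-≤ ℓ on a≤K b≤K with ·-onSegment ℓ on
... | t , 0≤t , t≤1 , eq = subst (_≤ℚ _) (sym eq) (convex-≤ 0≤t t≤1 a≤K b≤K)

onSegment-≥ : ∀ ℓ {p a b K} → OnSegment p a b → K ≤ℚ ℓ ·ℚ a → K ≤ℚ ℓ ·ℚ b → K ≤ℚ ℓ ·ℚ p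
onSegment-≥ ℓ on K≤a K≤b with ·-onSegment ℓ on
... | t , 0≤t , t≤1 , eq = subst (_ ≤ℚ_) (sym eq) (convex-≥ 0≤t t≤1 K≤a K≤b)

threshold⇒¬meet : ∀ ℓ K {a b c d} → ℓ ·ℤ a ℤ.≤ K → ℓ ·ℤ b ℤ.≤ K → K ℤ.< ℓ ·ℤ c → K ℤ.< ℓ ·ℤ d →
                  ¬ SegmentsMeet (embed a) (embed b) (embed c) (embed d)
threshold⇒¬meet ℓ K {a} {b} {c} {d} a≤K b≤K K<c K<d (p , on-ab , on-cd) =
  ℤ.<-irrefl refl (ℤ.suc[i]≤j⇒i<j (ι-cancel-≤ (ℚ.≤-trans above below)))
  where
  at-most : ∀ z → ℓ ·ℤ z ℤ.≤ K → embed ℓ ·ℚ embed z ≤ℚ ι K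
  at-most z z≤K = subst (_≤ℚ ι K) (sym (·-embed ℓ z)) (ι-mono-≤ z≤K)
  above-K : ∀ z → K ℤ.< ℓ ·ℤ z → ι (ℤ.suc K) ≤ℚ embed ℓ ·ℚ embed z
  above-K z K<z = subst (ι (ℤ.suc K) ≤ℚ_) (sym (·-embed ℓ z)) (ι-mono-≤ (ℤ.i<j⇒suc[i]≤j K<z))
  below : embed ℓ ·ℚ p ≤ℚ ι K
  below = onSegment-≤ (embed ℓ) {a = embed a} {b = embed b} on-ab (at-most a a≤K) (at-most b b≤K)
  above : ι (ℤ.suc K) ≤ℚ embed ℓ ·ℚ p
  above = onSegment-≥ (embed ℓ) {a = embed c} {b = embed d} on-cd (above-K c K<c) (above-K d K<d)

LineSeparates : ℤ × ℤ → (a b c d : ℤ × ℤ) → Set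
LineSeparates ℓ a b c d = (ℓ ·ℤ a ℤ.< ℓ ·ℤ c) × (ℓ ·ℤ a ℤ.< ℓ ·ℤ d) × (ℓ ·ℤ b ℤ.< ℓ ·ℤ c) × (ℓ ·ℤ b ℤ.< ℓ ·ℤ d)

separated⇒¬meet : ∀ ℓ {a b c d} → LineSeparates ℓ a b c d →
                  ¬ SegmentsMeet (embed a) (embed b) (embed c) (embed d)
separated⇒¬meet ℓ {a} {b} (a<c , a<d , b<c , b<d) with ℤ.≤-total (ℓ ·ℤ a) (ℓ ·ℤ b)
... | inj₁ a≤b = threshold⇒¬meet ℓ (ℓ ·ℤ b) a≤b ℤ.≤-refl b<c b<d
... | inj₂ b≤a = threshold⇒¬meet ℓ (ℓ ·ℤ a) ℤ.≤-refl b≤a a<c a<d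

infix 4 _<ᵇ_

_<ᵇ_ : ℤ → ℤ → Bool
i <ᵇ j = ℤ.suc i ℤ.≤ᵇ j

<ᵇ⇒< : ∀ {i j} → T (i <ᵇ j) → i ℤ.< j
<ᵇ⇒< = ℤ.suc[i]≤j⇒i<j ∘ ℤ.≤ᵇ⇒≤

separatesᵇ : ℤ × ℤ → (a b c d : ℤ × ℤ) → Bool
separatesᵇ ℓ a b c d = (ℓ ·ℤ a <ᵇ ℓ ·ℤ c) ∧ (ℓ ·ℤ a <ᵇ ℓ ·ℤ d) ∧ (ℓ ·ℤ b <ᵇ ℓ ·ℤ c) ∧ (ℓ ·ℤ b <ᵇ ℓ ·ℤ d)

separatesᵇ-sound : ∀ ℓ a b c d → T (separatesᵇ ℓ a b c d) → LineSeparates ℓ a b c d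
separatesᵇ-sound ℓ a b c d separates
  with a<c , rest ← Equivalence.to (Bool.T-∧ {ℓ ·ℤ a <ᵇ ℓ ·ℤ c}) separates
  with a<d , rest ← Equivalence.to (Bool.T-∧ {ℓ ·ℤ a <ᵇ ℓ ·ℤ d}) rest
  with b<c , b<d  ← Equivalence.to (Bool.T-∧ {ℓ ·ℤ b <ᵇ ℓ ·ℤ c}) rest
  = <ᵇ⇒< a<c , <ᵇ⇒< a<d , <ᵇ⇒< b<c , <ᵇ⇒< b<d

normal : ℤ × ℤ → ℤ × ℤ → ℤ × ℤ
normal (ax , ay) (bx , by) = ay ℤ.- by , bx ℤ.- ax

candidates : (a b c d : ℤ × ℤ) → List (ℤ × ℤ)
candidates a b c d = (ℤ.1ℤ , ℤ.0ℤ) ∷ (ℤ.0ℤ , ℤ.1ℤ) ∷ normal a b ∷ normal c d ∷ []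

apartᵇ : (a b c d : ℤ × ℤ) → Bool
apartᵇ a b c d = any (λ ℓ → separatesᵇ ℓ a b c d ∨ separatesᵇ ℓ c d a b) (candidates a b c d)

apartᵇ-sound : ∀ a b c d → T (apartᵇ a b c d) → ¬ SegmentsMeet (embed a) (embed b) (embed c) (embed d)
apartᵇ-sound a b c d apart
  with ℓ , separates ← satisfied (any⁻ (λ ℓ → separatesᵇ ℓ a b c d ∨ separatesᵇ ℓ c d a b)
                                      (candidates a b c d) apart)
  with Equivalence.to (Bool.T-∨ {separatesᵇ ℓ a b c d}) separates
... | inj₁ ab|cd = separated⇒¬meet ℓ (separatesᵇ-sound ℓ a b c d ab|cd)
... | inj₂ cd|ab = separated⇒¬meet ℓ (separatesᵇ-sound ℓ c d a b cd|ab)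
                 ∘ segmentsMeet-sym (embed a) (embed b) (embed c) (embed d)

allPairsᵇ : {A : Set} → (A → A → Bool) → List A → Bool
allPairsᵇ r []       = true
allPairsᵇ r (a ∷ as) = all (r a) as ∧ allPairsᵇ r as

allPairsᵇ-∈ : {A : Set} (r : A → A → Bool) {xs : List A} {a b : A} → T (allPairsᵇ r xs) →
              a ∈ xs → b ∈ xs → ¬ a ≡ b → T (r a b) ⊎ T (r b a)
allPairsᵇ-∈ r {a ∷ as} ok (here refl) (here refl) a≢b = contradiction refl a≢b
allPairsᵇ-∈ r {a ∷ as} ok (here refl) (there b∈)  _   =
  inj₁ (All.lookup (All.all⁺ (r a) as (proj₁ (Equivalence.to Bool.T-∧ ok))) b∈)
allPairsᵇ-∈ r {a ∷ as} ok (there a∈)  (here refl) _   =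
  inj₂ (All.lookup (All.all⁺ (r a) as (proj₁ (Equivalence.to Bool.T-∧ ok))) a∈)
allPairsᵇ-∈ r {a ∷ as} ok (there a∈)  (there b∈)  a≢b =
  allPairsᵇ-∈ r (proj₂ (Equivalence.to Bool.T-∧ ok)) a∈ b∈ a≢b

does-sound : ∀ {A : Set} (a? : Dec A) → T (does a?) → A
does-sound (yes a) _ = a

not-does-sound : ∀ {A : Set} (a? : Dec A) → T (not (does a?)) → ¬ A
not-does-sound (no ¬a) _ = ¬a

resolve : ∀ {a b} → ¬ T a → T (a ∨ b) → T b
resolve ¬a a∨b with Equivalence.to Bool.T-∨ a∨b
... | inj₁ a = contradiction a ¬a
... | inj₂ b = b

module DrawingCheck {V : Set} (_≟ᵥ_ : DecidableEquality V) (vertices : List V)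
                    (arc : V → V → Bool) (pos : V → ℤ × ℤ) where

  edges : List (V × V)
  edges = filter (λ e → T? (arc (proj₁ e) (proj₂ e))) (cartesianProduct vertices vertices)

  endpointᵇ : V → V × V → Bool
  endpointᵇ w (u , v) = does (w ≟ᵥ u) ∨ does (w ≟ᵥ v)

  shareEndpointᵇ : V × V → V × V → Bool
  shareEndpointᵇ e (x , y) = endpointᵇ x e ∨ endpointᵇ y e

  apartᵥ : V × V → V × V → Bool
  apartᵥ (u , v) (x , y) = apartᵇ (pos u) (pos v) (pos x) (pos y)

  _≟ₚ_ : DecidableEquality (ℤ × ℤ)
  _≟ₚ_ = Product.≡-dec ℤ._≟_ ℤ._≟_

  distinctPositionsᵇ verticesOffEdgesᵇ edgesDisjointᵇ : Bool
  distinctPositionsᵇ = allPairsᵇ (λ u v → not (does (pos u ≟ₚ pos v))) vertices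
  verticesOffEdgesᵇ  = all (λ e → all (λ w → endpointᵇ w e ∨ apartᵥ e (w , w)) vertices) edges
  edgesDisjointᵇ     = allPairsᵇ (λ e e' → shareEndpointᵇ e e' ∨ apartᵥ e e') edges

  -- ≡ true rather than T: proving it by refl is far faster than solving T's unit metavariable.
  Drawable : Set
  Drawable = (distinctPositionsᵇ ≡ true) × (verticesOffEdgesᵇ ≡ true) × (edgesDisjointᵇ ≡ true)

  data Orientation (u v : V) : V × V → Set where
    forward  : Orientation u v (u , v)
    backward : Orientation u v (v , u)

  point : V → Point
  point = embed ∘ pos

  private
    reorient-on : ∀ {u v e p} → Orientation u v e → OnSegment p (point u) (point v) →
                  OnSegment p (point (proj₁ e)) (point (proj₂ e))
    reorient-on         forward  on = on
    reorient-on {u} {v} backward on = onSegment-sym (point u) (point v) on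

    reorient : ∀ {u v x y e e'} → Orientation u v e → Orientation x y e' →
               SegmentsMeet (point u) (point v) (point x) (point y) →
               SegmentsMeet (point (proj₁ e)) (point (proj₂ e)) (point (proj₁ e')) (point (proj₂ e'))
    reorient o o' (p , on , on') = p , reorient-on o on , reorient-on o' on'

    not-endpoint : ∀ {u v w e} → Orientation u v e → ¬ w ≡ u → ¬ w ≡ v → ¬ T (endpointᵇ w e)
    not-endpoint {u} {v} {w} o w≢u w≢v is-end with Equivalence.to Bool.T-∨ is-end | o
    ... | inj₁ w≡ | forward  = w≢u (does-sound (w ≟ᵥ u) w≡)
    ... | inj₂ w≡ | forward  = w≢v (does-sound (w ≟ᵥ v) w≡)
    ... | inj₁ w≡ | backward = w≢v (does-sound (w ≟ᵥ v) w≡)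
    ... | inj₂ w≡ | backward = w≢u (does-sound (w ≟ᵥ u) w≡)

    no-shared : ∀ {a b c d e e'} → Orientation a b e → Orientation c d e' →
                ¬ a ≡ c → ¬ a ≡ d → ¬ b ≡ c → ¬ b ≡ d → ¬ T (shareEndpointᵇ e e')
    no-shared o forward a≢c a≢d b≢c b≢d shared with Equivalence.to Bool.T-∨ shared
    ... | inj₁ c-end = not-endpoint o (a≢c ∘ sym) (b≢c ∘ sym) c-end
    ... | inj₂ d-end = not-endpoint o (a≢d ∘ sym) (b≢d ∘ sym) d-end
    no-shared o backward a≢c a≢d b≢c b≢d shared with Equivalence.to Bool.T-∨ shared
    ... | inj₁ d-end = not-endpoint o (a≢d ∘ sym) (b≢d ∘ sym) d-end
    ... | inj₂ c-end = not-endpoint o (a≢c ∘ sym) (b≢c ∘ sym) c-end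

    different : ∀ {a b c d e e'} → Orientation a b e → Orientation c d e' →
                ¬ a ≡ c → ¬ a ≡ d → ¬ b ≡ c → ¬ b ≡ d → ¬ e ≡ e'
    different forward  forward  a≢c a≢d b≢c b≢d = a≢c ∘ cong proj₁
    different forward  backward a≢c a≢d b≢c b≢d = a≢d ∘ cong proj₁
    different backward forward  a≢c a≢d b≢c b≢d = b≢c ∘ cong proj₁
    different backward backward a≢c a≢d b≢c b≢d = b≢d ∘ cong proj₁

  drawing : (∀ v → v ∈ vertices) → ∀ {n} (decode : Fin n → V) → Injective _≡_ _≡_ decode →
            (loopless : ∀ v → arc v v ≡ false) →
            Drawable → PlanarDrawing (symmetrise (λ u v → arc (decode u) (decode v)) (loopless ∘ decode))
  drawing complete {n} decode decode-injective loopless (positions-ok , off-edges-ok , disjoint-ok) = record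
    { pos         = point ∘ decode
    ; pos-inj     = pos-inj
    ; vertex-free = vertex-free
    ; edge-free   = edge-free
    }
    where
    G = symmetrise (λ u v → arc (decode u) (decode v)) (loopless ∘ decode)

    distinct : ∀ {u v} → ¬ u ≡ v → ¬ decode u ≡ decode v
    distinct u≢v = u≢v ∘ decode-injective

    edge-in : ∀ {u v} → adj G u v ≡ true → Σ (V × V) λ e → e ∈ edges × Orientation (decode u) (decode v) e
    edge-in uv with Equivalence.to Bool.T-∨ (Equivalence.from Bool.T-≡ uv)
    ... | inj₁ uv-arc = _ , ∈-filter⁺ (λ e → T? (arc (proj₁ e) (proj₂ e)))
                              (∈-cartesianProduct⁺ (complete _) (complete _)) uv-arc , forward
    ... | inj₂ vu-arc = _ , ∈-filter⁺ (λ e → T? (arc (proj₁ e) (proj₂ e)))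
                              (∈-cartesianProduct⁺ (complete _) (complete _)) vu-arc , backward

    pos-inj : Injective _≡_ _≡_ (point ∘ decode)
    pos-inj {u} {v} same with decode u ≟ᵥ decode v
    ... | yes du≡dv = decode-injective du≡dv
    ... | no  du≢dv with allPairsᵇ-∈ (λ u v → not (does (pos u ≟ₚ pos v))) (Equivalence.from Bool.T-≡ positions-ok)
                                     (complete (decode u)) (complete (decode v)) du≢dv
    ...   | inj₁ differ = ⊥-elim (not-does-sound (_ ≟ₚ _) differ (embed-injective same))
    ...   | inj₂ differ = ⊥-elim (not-does-sound (_ ≟ₚ _) differ (sym (embed-injective same)))

    vertex-free : ∀ u v w → adj G u v ≡ true → ¬ w ≡ u → ¬ w ≡ v →
                  ¬ OnSegment (point (decode w)) (point (decode u)) (point (decode v))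
    vertex-free u v w uv w≢u w≢v on with edge-in uv
    ... | e , e∈ , o =
      apartᵇ-sound (pos (proj₁ e)) (pos (proj₂ e)) (pos (decode w)) (pos (decode w))
        (resolve (not-endpoint o (distinct w≢u) (distinct w≢v)) off)
        (point (decode w) , reorient-on o on , onSegment-start (point (decode w)) (point (decode w)))
      where
      off : T (endpointᵇ (decode w) e ∨ apartᵥ e (decode w , decode w))
      off = All.lookup (All.all⁺ (λ w → endpointᵇ w e ∨ apartᵥ e (w , w)) vertices
              (All.lookup (All.all⁺ (λ e → all (λ w → endpointᵇ w e ∨ apartᵥ e (w , w)) vertices) edges
                                    (Equivalence.from Bool.T-≡ off-edges-ok)) e∈))
              (complete (decode w))

    edge-free : ∀ u v x y → adj G u v ≡ true → adj G x y ≡ true →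
                ¬ u ≡ x → ¬ u ≡ y → ¬ v ≡ x → ¬ v ≡ y →
                ¬ SegmentsMeet (point (decode u)) (point (decode v)) (point (decode x)) (point (decode y))
    edge-free u v x y uv xy u≢x u≢y v≢x v≢y =
      disjoint uv xy (distinct u≢x) (distinct u≢y) (distinct v≢x) (distinct v≢y)
      where
      disjoint : adj G u v ≡ true → adj G x y ≡ true →
                 ¬ decode u ≡ decode x → ¬ decode u ≡ decode y → ¬ decode v ≡ decode x → ¬ decode v ≡ decode y →
                 ¬ SegmentsMeet (point (decode u)) (point (decode v)) (point (decode x)) (point (decode y))
      disjoint uv xy ux uy vx vy meet with edge-in uv | edge-in xy
      ... | e , e∈ , o | e' , e'∈ , o'
        with allPairsᵇ-∈ (λ e e' → shareEndpointᵇ e e' ∨ apartᵥ e e') (Equivalence.from Bool.T-≡ disjoint-ok)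
                         e∈ e'∈ (different o o' ux uy vx vy)
      ... | inj₁ apart =
        apartᵇ-sound (pos (proj₁ e)) (pos (proj₂ e)) (pos (proj₁ e')) (pos (proj₂ e'))
          (resolve (no-shared o o' ux uy vx vy) apart) (reorient o o' meet)
      ... | inj₂ apart =
        apartᵇ-sound (pos (proj₁ e')) (pos (proj₂ e')) (pos (proj₁ e)) (pos (proj₂ e))
          (resolve (no-shared o' o (ux ∘ sym) (vx ∘ sym) (uy ∘ sym) (vy ∘ sym)) apart)
          (segmentsMeet-sym (point (proj₁ e)) (point (proj₂ e)) (point (proj₁ e')) (point (proj₂ e'))
                            (reorient o o' meet))

-- The graph and its cover

-- A window is one of the 7 copies of the gadget joined to north with each of the 3 possible voltages.
Window : Set
Window = Fin 7 × Fin 3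

-- The gadget: a path p₀ … p₄ and triangles l₁ , u₁ on its edge p₁p₂ and l₂ , u₂ on p₂p₃;
-- the lower triangles lᵢ are joined to south, the upper ones uᵢ to north.
Gadget : Set
Gadget = Fin 5 ⊎ (Fin 2 ⊎ Fin 2)

pattern path i  = inj₁ i
pattern lower j = inj₂ (inj₁ j)
pattern upper j = inj₂ (inj₂ j)

pattern p₀ = path zero
pattern p₁ = path (suc zero)
pattern p₂ = path (suc (suc zero))
pattern p₃ = path (suc (suc (suc zero)))
pattern p₄ = path (suc (suc (suc (suc zero))))
pattern l₁ = lower zero
pattern l₂ = lower (suc zero)
pattern u₁ = upper zero
pattern u₂ = upper (suc zero)

Vertex : Set
Vertex = Fin 2 ⊎ (Window × Gadget)

pattern south    = inj₁ zero
pattern north    = inj₁ (suc zero)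
pattern node w g = inj₂ (w , g)

order : ℕ
order = 2 + 21 * (5 + (2 + 2))

opaque
  vertices↔ : Fin order ↔ Vertex
  vertices↔ = ↔-trans +↔⊎ (↔-refl ⊎-↔ ↔-trans *↔× (*↔× ×-↔ ↔-trans +↔⊎ (↔-refl ⊎-↔ +↔⊎)))

  decode : Fin order → Vertex
  decode = Inverse.to vertices↔

  encode : Vertex → Fin order
  encode = Inverse.from vertices↔

  decode-encode : ∀ v → decode (encode v) ≡ v
  decode-encode = Inverse.strictlyInverseˡ vertices↔

  encode-injective : Injective _≡_ _≡_ encode
  encode-injective {v} {v'} e = trans (sym (decode-encode v)) (trans (cong decode e) (decode-encode v'))

  decode-injective : Injective _≡_ _≡_ decode
  decode-injective {i} {j} e = trans (sym (Inverse.strictlyInverseʳ vertices↔ i))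
                                     (trans (cong encode e) (Inverse.strictlyInverseʳ vertices↔ j))

node-injective : ∀ {w g g'} → _≡_ {A = Vertex} (node w g) (node w g') → g ≡ g'
node-injective refl = refl

_≟ʷ_ : DecidableEquality Window
_≟ʷ_ = Product.≡-dec _≟_ _≟_

_≟ᵍ_ : DecidableEquality Gadget
_≟ᵍ_ = Sum.≡-dec _≟_ (Sum.≡-dec _≟_ _≟_)

_≟ᵛ_ : DecidableEquality Vertex
_≟ᵛ_ = Sum.≡-dec _≟_ (Product.≡-dec _≟ʷ_ _≟ᵍ_)

-- Voltages in ℤ/3: along an arc v → u of voltage s, colour i at v conflicts with colour i + s at u.
gadgetVoltage : Gadget → Gadget → Maybe (Fin 3)
gadgetVoltage p₀ p₁ = just zero
gadgetVoltage p₁ p₂ = just zero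
gadgetVoltage p₂ p₃ = just zero
gadgetVoltage p₃ p₄ = just zero
gadgetVoltage p₁ l₁ = just zero
gadgetVoltage p₂ l₁ = just one
gadgetVoltage p₁ u₁ = just zero
gadgetVoltage p₂ u₁ = just one
gadgetVoltage p₂ l₂ = just zero
gadgetVoltage p₃ l₂ = just one
gadgetVoltage p₂ u₂ = just zero
gadgetVoltage p₃ u₂ = just one
gadgetVoltage _  _  = nothing

southVoltage : Gadget → Maybe (Fin 3)
southVoltage (path _)  = just zero
southVoltage (lower _) = just one
southVoltage (upper _) = nothing

northVoltage : Fin 3 → Gadget → Maybe (Fin 3)
northVoltage s (path _)  = just s
northVoltage s (lower _) = nothing
northVoltage s (upper _) = just s

voltage : Vertex → Vertex → Maybe (Fin 3)
voltage south      (node w g)       = southVoltage g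
voltage north      (node (_ , s) g) = northVoltage s g
voltage (node w g) (node w' g')     = if does (w ≟ʷ w') then gadgetVoltage g g' else nothing
voltage _          _                = nothing

voltage-in-window : ∀ w g g' → voltage (node w g) (node w g') ≡ gadgetVoltage g g'
voltage-in-window w g g' rewrite dec-true (w ≟ʷ w) refl = refl

arc : Vertex → Vertex → Bool
arc v u = is-just (voltage v u)

arc-loopless : ∀ v → arc v v ≡ false
arc-loopless south      = refl
arc-loopless north      = refl
arc-loopless (node w g) rewrite voltage-in-window w g g = gadget-loopless g
  where
  gadget-loopless : ∀ g → is-just (gadgetVoltage g g) ≡ false
  gadget-loopless (path i)  = from-yes (all? λ i → is-just (gadgetVoltage (path i) (path i)) Bool.≟ false) i
  gadget-loopless (lower _) = refl
  gadget-loopless (upper _) = refl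

σ : Vertex → Vertex → Fin 3
σ v u = fromMaybe zero (voltage v u) -₃ fromMaybe zero (voltage u v)

σ-inverse : ∀ v u c → c +₃ σ v u +₃ σ u v ≡ c
σ-inverse v u c = +₃-cancel c (fromMaybe zero (voltage v u)) (fromMaybe zero (voltage u v))

G : SimpleGraph order
G = symmetrise (λ i j → arc (decode i) (decode j)) (arc-loopless ∘ decode)

open PermutationCover G 3 (λ i j c → c +₃ σ (decode i) (decode j)) (λ i j → σ-inverse (decode i) (decode j))
  using (colourOf; conflict; kFold) renaming (cover to 𝓗)

-- No 3-defective colouring

-- With north voltage a + 1 - b on a window, south forbids colour a on its path vertices and north forbids a + 1.
path-forced : ∀ a b c → ¬ c ≡ a +₃ zero → ¬ c ≡ b +₃ (a +₃ one -₃ b -₃ zero) → c ≡ a +₃ two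
path-forced = from-yes (all? λ a → all? λ b → all? λ c →
  ¬? (c ≟ a +₃ zero) →-dec ¬? (c ≟ b +₃ (a +₃ one -₃ b -₃ zero)) →-dec c ≟ a +₃ two)

lower-forced : ∀ a c → ¬ c ≡ a +₃ one → c ≡ a +₃ two ⊎ c ≡ a +₃ two +₃ one
lower-forced = from-yes (all? λ a → all? λ c →
  ¬? (c ≟ a +₃ one) →-dec (c ≟ a +₃ two ⊎-dec c ≟ a +₃ two +₃ one))

upper-forced : ∀ a b c → ¬ c ≡ b +₃ (a +₃ one -₃ b -₃ zero) → c ≡ a +₃ two ⊎ c ≡ a +₃ two +₃ one
upper-forced = from-yes (all? λ a → all? λ b → all? λ c →
  ¬? (c ≟ b +₃ (a +₃ one -₃ b -₃ zero)) →-dec (c ≟ a +₃ two ⊎-dec c ≟ a +₃ two +₃ one))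

adjacent : Vertex → Vertex → Bool
adjacent v u = arc v u ∨ arc u v

gadgetAdjacent : Gadget → Gadget → Bool
gadgetAdjacent g g' = is-just (gadgetVoltage g g') ∨ is-just (gadgetVoltage g' g)

gadgetσ : Gadget → Gadget → Fin 3
gadgetσ g g' = fromMaybe zero (gadgetVoltage g g') -₃ fromMaybe zero (gadgetVoltage g' g)

any-gadget? : ∀ {P : Gadget → Set} → Decidable P → Dec (∃ P)
any-gadget? P? with any? (P? ∘ path) | any? (P? ∘ lower) | any? (P? ∘ upper)
... | yes (i , Pi) | _            | _            = yes (path i , Pi)
... | _            | yes (j , Pj) | _            = yes (lower j , Pj)
... | _            | _            | yes (j , Pj) = yes (upper j , Pj)
... | no ¬path     | no ¬lower    | no ¬upper    = no λ where
  (path i  , Pi) → ¬path (i , Pi)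
  (lower j , Pj) → ¬lower (j , Pj)
  (upper j , Pj) → ¬upper (j , Pj)

module _ (col : HColoring 𝓗) (defective : Defective 3 col) where

  colour : Vertex → Fin 3
  colour v = colourOf (φ col (encode v))

  Conflicting : Vertex → Fin order → Bool
  Conflicting v u = adj G (encode v) u ∧ adj (H 𝓗) (φ col (encode v)) (φ col u)

  Conflict : Vertex → Vertex → Set
  Conflict v u = Conflicting v (encode u) ≡ true

  -- Via count-cong: matching count (Conflicting v) against Defective by conversion would unfold count.
  conflict-bound : ∀ v → count (Conflicting v) ≤ 3
  conflict-bound v =
    subst (_≤ 3) (count-cong {f = λ u → adj G (encode v) u ∧ adj (H 𝓗) (φ col (encode v)) (φ col u)}
                             {g = Conflicting v} λ _ → refl)
          (defective (encode v))

  conflict-of : ∀ {v u} → adjacent v u ≡ true → colour u ≡ colour v +₃ σ v u → Conflict v u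
  conflict-of {v} {u} vu same = conflict col
    (subst₂ (λ x y → arc x y ∨ arc y x ≡ true) (sym (decode-encode v)) (sym (decode-encode u)) vu)
    (subst₂ (λ x y → colour u ≡ colour v +₃ σ x y) (sym (decode-encode v)) (sym (decode-encode u)) same)

  window-conflict : ∀ w g g' → gadgetAdjacent g g' ≡ true →
                    colour (node w g') ≡ colour (node w g) +₃ gadgetσ g g' → Conflict (node w g) (node w g')
  window-conflict w g g' gg' same = conflict-of
    (subst₂ (λ x y → is-just x ∨ is-just y ≡ true)
            (sym (voltage-in-window w g g')) (sym (voltage-in-window w g' g)) gg')
    (subst₂ (λ x y → colour (node w g') ≡ colour (node w g) +₃ (fromMaybe zero x -₃ fromMaybe zero y))
            (sym (voltage-in-window w g g')) (sym (voltage-in-window w g' g)) same)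

  few-conflicts : ∀ v {us} → Unique us → All (Conflict v) us → length us ≤ 3
  few-conflicts v {us} unique conflicts = ≤-trans (≤-reflexive (sym (length-map encode us)))
    (≤-trans (count-unique (Conflicting v) (Unique.map⁺ encode-injective unique) (All.map⁺ conflicts))
             (conflict-bound v))

  a b s* κ : Fin 3
  a  = colour south
  b  = colour north
  s* = a +₃ one -₃ b
  κ  = a +₃ two

  Escapes : Window → Set
  Escapes w = Σ Gadget λ g → Conflict south (node w g) ⊎ Conflict north (node w g)

  escapes? : ∀ w → Dec (Escapes w)
  escapes? w = any-gadget? λ g → (_ Bool.≟ true) ⊎-dec (_ Bool.≟ true)

  module Trapped (k : Fin 7) (trapped : ¬ Escapes (k , s*)) where

    w : Window
    w = k , s*

    avoids-south : ∀ g → adjacent south (node w g) ≡ true → ¬ colour (node w g) ≡ a +₃ σ south (node w g)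
    avoids-south g adjacent e = trapped (g , inj₁ (conflict-of adjacent e))

    avoids-north : ∀ g → adjacent north (node w g) ≡ true → ¬ colour (node w g) ≡ b +₃ σ north (node w g)
    avoids-north g adjacent e = trapped (g , inj₂ (conflict-of adjacent e))

    path-colour : ∀ i → colour (node w (path i)) ≡ κ
    path-colour i = path-forced a b _ (avoids-south (path i) refl) (avoids-north (path i) refl)

    Options : Gadget → Set
    Options t = colour (node w t) ≡ κ ⊎ colour (node w t) ≡ κ +₃ one

    lower-colour : ∀ j → Options (lower j)
    lower-colour j = lower-forced a _ (avoids-south (lower j) refl)

    upper-colour : ∀ j → Options (upper j)
    upper-colour j = upper-forced a b _ (avoids-north (upper j) refl)

    joins-first : ∀ {i t} → gadgetAdjacent (path i) t ≡ true → gadgetσ (path i) t ≡ zero →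
                  colour (node w t) ≡ κ → Conflict (node w (path i)) (node w t)
    joins-first {i} {t} adjacent σ≡0 t≡κ = window-conflict w (path i) t adjacent
      (trans t≡κ (trans (sym (+₃-identityʳ κ)) (cong₂ _+₃_ (sym (path-colour i)) (sym σ≡0))))

    joins-second : ∀ {i t} → gadgetAdjacent (path i) t ≡ true → gadgetσ (path i) t ≡ one →
                   colour (node w t) ≡ κ +₃ one → Conflict (node w (path i)) (node w t)
    joins-second {i} {t} adjacent σ≡1 t≡κ+1 = window-conflict w (path i) t adjacent
      (trans t≡κ+1 (cong₂ _+₃_ (sym (path-colour i)) (sym σ≡1)))

    path-conflict : ∀ {i i'} → gadgetAdjacent (path i) (path i') ≡ true → gadgetσ (path i) (path i') ≡ zero →
                    Conflict (node w (path i)) (node w (path i'))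
    path-conflict {i} {i'} adjacent σ≡0 = joins-first adjacent σ≡0 (path-colour i')

    overloaded : ∀ g t₁ t₂ t₃ t₄ {distinct : True (UniqueDec.unique? _≟ᵍ_ (t₁ ∷ t₂ ∷ t₃ ∷ t₄ ∷ []))} →
                 All (Conflict (node w g) ∘ node w) (t₁ ∷ t₂ ∷ t₃ ∷ t₄ ∷ []) → ⊥
    overloaded g t₁ t₂ t₃ t₄ {distinct} conflicts =
      n≮n 3 (few-conflicts (node w g) (Unique.map⁺ node-injective (toWitness distinct)) (All.map⁺ conflicts))

    -- A triangle coloured κ conflicts with its first path vertex, one coloured κ + 1 with its second;
    -- with two conflicts already on the path, one of p₁ , p₂ , p₃ receives two triangles.
    impossible : ⊥
    impossible = by-cases (lower-colour zero) (upper-colour zero)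
                          (lower-colour (suc zero)) (upper-colour (suc zero))
      where
      by-cases : Options l₁ → Options u₁ → Options l₂ → Options u₂ → ⊥
      by-cases (inj₁ l₁κ) (inj₁ u₁κ) _          _          = overloaded p₁ p₀ p₂ l₁ u₁
        (path-conflict refl refl ∷ path-conflict refl refl ∷
         joins-first refl refl l₁κ ∷ joins-first refl refl u₁κ ∷ [])
      by-cases _          _          (inj₂ l₂κ) (inj₂ u₂κ) = overloaded p₃ p₂ p₄ l₂ u₂
        (path-conflict refl refl ∷ path-conflict refl refl ∷
         joins-second refl refl l₂κ ∷ joins-second refl refl u₂κ ∷ [])
      by-cases (inj₂ l₁κ) _          (inj₁ l₂κ) _          = overloaded p₂ p₁ p₃ l₁ l₂
        (path-conflict refl refl ∷ path-conflict refl refl ∷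
         joins-second refl refl l₁κ ∷ joins-first refl refl l₂κ ∷ [])
      by-cases (inj₂ l₁κ) _          _          (inj₁ u₂κ) = overloaded p₂ p₁ p₃ l₁ u₂
        (path-conflict refl refl ∷ path-conflict refl refl ∷
         joins-second refl refl l₁κ ∷ joins-first refl refl u₂κ ∷ [])
      by-cases _          (inj₂ u₁κ) (inj₁ l₂κ) _          = overloaded p₂ p₁ p₃ u₁ l₂
        (path-conflict refl refl ∷ path-conflict refl refl ∷
         joins-second refl refl u₁κ ∷ joins-first refl refl l₂κ ∷ [])
      by-cases _          (inj₂ u₁κ) _          (inj₁ u₂κ) = overloaded p₂ p₁ p₃ u₁ u₂
        (path-conflict refl refl ∷ path-conflict refl refl ∷
         joins-second refl refl u₁κ ∷ joins-first refl refl u₂κ ∷ [])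

  window-escapes : ∀ k → Escapes (k , s*)
  window-escapes k = decide (escapes? (k , s*))
    where
    decide : Dec (Escapes (k , s*)) → Escapes (k , s*)
    decide (yes escape)  = escape
    decide (no  trapped) = ⊥-elim (Trapped.impossible k trapped)

  witness : Fin 7 → Fin order
  witness k = encode (node (k , s*) (proj₁ (window-escapes k)))

  witness-injective : ∀ {k k'} → witness k ≡ witness k' → k ≡ k'
  witness-injective = cong (proj₁ ∘ proj₁) ∘ Sum.inj₂-injective ∘ encode-injective

  witness-conflicts : ∀ k → Conflicting south (witness k) ∨ Conflicting north (witness k) ≡ true
  witness-conflicts k = either (proj₂ (window-escapes k))
    where
    either : ∀ {x y} → x ≡ true ⊎ y ≡ true → x ∨ y ≡ true
    either     (inj₁ refl) = refl
    either {x} (inj₂ refl) = Bool.∨-zeroʳ x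

  -- g is given explicitly: inferring it by unification normalises witness, which is very costly.
  apexes-overloaded : ⊥
  apexes-overloaded = n≮n 6 (≤-trans (count-injective (λ u → Conflicting south u ∨ Conflicting north u)
                                                      {g = witness} witness-injective witness-conflicts)
                             (≤-trans (count-∨ (Conflicting south) (Conflicting north))
                                      (+-mono-≤ (conflict-bound south) (conflict-bound north))))

no-3-defective-colouring : ¬ Σ (HColoring 𝓗) (Defective 3)
no-3-defective-colouring (col , defective) = apexes-overloaded col defective

-- The drawing

windowOffset : Window → ℕ
windowOffset (k , s) = 12 * (3 * toℕ k + toℕ s)

-- South and north lie far below and above the row of windows, so their edges are almost vertical near it.
position : Vertex → ℤ × ℤ
position south              = + 124 , - + 10000
position north              = + 124 , + 10000
position (node w (path i))  = + (windowOffset w + 2 * toℕ i) , + 0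
position (node w (lower j)) = + (windowOffset w + 3 + 2 * toℕ j) , - + 1
position (node w (upper j)) = + (windowOffset w + 3 + 2 * toℕ j) , + 1

windows : List Window
windows = cartesianProduct (allFin 7) (allFin 3)

gadgets : List Gadget
gadgets = map path (allFin 5) ++ map lower (allFin 2) ++ map upper (allFin 2)

vertexList : List Vertex
vertexList = south ∷ north ∷ concatMap (λ w → map (node w) gadgets) windows

vertexList-complete : ∀ v → v ∈ vertexList
vertexList-complete south      = here refl
vertexList-complete north      = there (here refl)
vertexList-complete (node w g) =
  there (there (∈-concatMap⁺ (λ w → map (node w) gadgets)
                             (Any.map (λ { refl → ∈-map⁺ (node w) (gadget∈ g) }) window∈)))
  where
  window∈ : w ∈ windows
  window∈ = ∈-cartesianProduct⁺ (∈-allFin (proj₁ w)) (∈-allFin (proj₂ w))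
  gadget∈ : ∀ g → g ∈ gadgets
  gadget∈ (path i)  = ∈-++⁺ˡ (∈-map⁺ path (∈-allFin i))
  gadget∈ (lower j) = ∈-++⁺ʳ (map path (allFin 5)) (∈-++⁺ˡ (∈-map⁺ lower (∈-allFin j)))
  gadget∈ (upper j) = ∈-++⁺ʳ (map path (allFin 5)) (∈-++⁺ʳ (map lower (allFin 2)) (∈-map⁺ upper (∈-allFin j)))

open DrawingCheck _≟ᵛ_ vertexList arc position using (Drawable; drawing)

drawable : Drawable
drawable = refl , refl , refl

planar : Planar G
planar = drawing vertexList-complete decode decode-injective arc-loopless drawable

theorem1p2 : Σ ℕ λ n → Σ (SimpleGraph n) λ G →
               Planar G ×
               Σ (CorrespondenceCover G) λ 𝓗 →
                 KFold 3 𝓗 × ¬ (Σ (HColoring 𝓗) λ col → Defective 3 col)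
theorem1p2 = order , G , planar , 𝓗 , kFold , no-3-defective-colouring
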